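{- (Completeness for $\mathcal{U}$) For any closed formula $A$ and closed context $\Gamma$ of MQC, in the universal IK-CPS model $\mathcal{U}$: (reify) if $\Gamma\Vdash A$, then there is a proof term $p$ in normal form with $\Gamma\vdash p:A$; (reflect) if $e$ is a neutral proof term with $\Gamma\vdash e:A$, then $\Gamma\Vdash A$.
   Context: MQC is minimal intuitionistic predicate logic: natural deduction with proof terms, judgements $\Gamma\vdash p:A$, rules: axiom $a$; $\wedge$: $(p,q)$, $\pi_1p$, $\pi_2p$; $\vee$: $\iota_1p$, $\iota_2p$, $\mathrm{case}\ p\ \mathrm{of}\ (a_1.q_1\|a_2.q_2)$ (from $\Gamma\vdash p:A_1\vee A_2$, $\Gamma,a_i:A_i\vdash q_i:C$ infer $C$); $\Rightarrow$: $\lambda a.p$, $p\,q$; $\forall$: $\lambda x.p$ ($x$ fresh), $p\,t$; $\exists$: $(t,p)$ from $A(t)$, and $\mathrm{dest}\ p\ \mathrm{as}\ (x,a)\ \mathrm{in}\ q$ (from $\Gamma\vdash p:\exists x.A(x)$ and $\Gamma,a:A(x)\vdash q:C$, $x$ fresh, infer $C$). Normal terms $r$ and neutral terms $e$ are defined by $r ::= e \mid \lambda a.r \mid \iota_1 r\mid \iota_2 r\mid (r_1,r_2)\mid \lambda x.r\mid (t,r)$, $e ::= a \mid e\,r \mid \mathrm{case}\ e\ \mathrm{of}\ (a_1.r_1\|a_2.r_2)\mid \pi_1 e\mid \pi_2 e\mid e\,t\mid \mathrm{dest}\ e\ \mathrm{as}\ (x,a)\ \mathrm{in}\ r$. A derivation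 is in normal form if its proof term is normal. An IK-CPS model consists of a preorder $(K,\le)$ of worlds, a binary relation $w\Vdash_\bot^{C}$ between worlds and formulas, a monotone strong forcing $w\Vdash_s X$ on atomic formulas, and increasing domains $D(w)$. Strong forcing is extended simultaneously with forcing: $w \Vdash A$ iff for every formula $C$ and every $w'\ge w$, if for all $w''\ge w'$ ($w''\Vdash_s A$ implies $w''\Vdash_\bot^{C}$), then $w'\Vdash_\bot^{C}$; $w\Vdash_s A\wedge B$ iff $w\Vdash A$ and $w\Vdash B$; $w\Vdash_s A\vee B$ iff $w\Vdash A$ or $w\Vdash B$; $w\Vdash_s A\Rightarrow B$ iff for all $w'\ge w$, $w'\Vdash A$ implies $w'\Vdash B$; $w\Vdash_s\forall x.A(x)$ iff for all $w'\ge w$, $t\in D(w')$, $w'\Vdash A(t)$; $w\Vdash_s\exists x.A(x)$ iff $w\Vdash A(t)$ for some $t\in D(w)$. The universal model $\mathcal{U}$: worlds are contexts $\Gamma$ of MQC ordered by inclusion; $\Gamma\Vdash_s X$ iff there is a normal derivation of $\Gamma\vdash X$ ($X$ atomic); $\Gamma\Vdash_\bot^{C}$ iff there is a normal derivation of $\Gamma\vdash C$; $D(\Gamma)$ is a constant set of individuals of MQC. -}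

module Defs where

open import Data.Nat using (ℕ; zero; suc)
open import Data.Fin using (Fin; zero; suc)
open import Data.List using (List; []; _∷_)
open import Data.List.Relation.Unary.All using (All)
open import Data.List.Relation.Binary.Subset.Propositional using (_⊆_)
open import Data.Product using (Σ; _×_; _,_)
open import Data.Sum using (_⊎_)
open import Data.Unit using (⊤)
open import Relation.Binary.PropositionalEquality using (_≡_; _≢_)

-- Individual terms are scoped: `Term n` has `n` bound variables
-- (de Bruijn, `var`) in scope, free variables/parameters `par k`
-- (named by natural numbers), and function symbols `fn f ts`
-- (symbol named by a natural number, applied to a list of arguments).
-- A term / formula is *closed* when it has no dangling bound variable,
-- i.e. it lives at scope 0 (it may contain parameters).

data Term (n : ℕ) : Set where
  var : Fin n → Term n
  par : ℕ → Term n
  fn  : ℕ → List (Term n) → Term n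

infixr 6 _∧_
infixr 5 _∨_
infixr 4 _⇒_

data Formula (n : ℕ) : Set where
  atom : ℕ → List (Term n) → Formula n
  _∧_  : Formula n → Formula n → Formula n
  _∨_  : Formula n → Formula n → Formula n
  _⇒_  : Formula n → Formula n → Formula n
  ∀'   : Formula (suc n) → Formula n
  ∃'   : Formula (suc n) → Formula n

CTerm : Set
CTerm = Term 0

CFormula : Set
CFormula = Formula 0

Ctx : Set
Ctx = List CFormula

mutual
  renT : ∀ {n m} → (Fin n → Fin m) → Term n → Term m
  renT r (var i)   = var (r i)
  renT r (par k)   = par k
  renT r (fn f ts) = fn f (renTs r ts)

  renTs : ∀ {n m} → (Fin n → Fin m) → List (Term n) → List (Term m)
  renTs r []       = []
  renTs r (t ∷ ts) = renT r t ∷ renTs r ts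

mutual
  substT : ∀ {n m} → (Fin n → Term m) → Term n → Term m
  substT σ (var i)   = σ i
  substT σ (par k)   = par k
  substT σ (fn f ts) = fn f (substTs σ ts)

  substTs : ∀ {n m} → (Fin n → Term m) → List (Term n) → List (Term m)
  substTs σ []       = []
  substTs σ (t ∷ ts) = substT σ t ∷ substTs σ ts

exts : ∀ {n m} → (Fin n → Term m) → Fin (suc n) → Term (suc m)
exts σ zero    = var zero
exts σ (suc i) = renT suc (σ i)

substF : ∀ {n m} → (Fin n → Term m) → Formula n → Formula m
substF σ (atom P ts) = atom P (substTs σ ts)
substF σ (A ∧ B)     = substF σ A ∧ substF σ B
substF σ (A ∨ B)     = substF σ A ∨ substF σ B
substF σ (A ⇒ B)     = substF σ A ⇒ substF σ B
substF σ (∀' A)      = ∀' (substF (exts σ) A)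
substF σ (∃' A)      = ∃' (substF (exts σ) A)

_▸_ : ∀ {n} → (Fin n → CTerm) → CTerm → Fin (suc n) → CTerm
(ρ ▸ t) zero    = t
(ρ ▸ t) (suc i) = ρ i

emptyEnv : Fin 0 → CTerm
emptyEnv ()

_[_] : Formula 1 → CTerm → CFormula
A [ t ] = substF (emptyEnv ▸ t) A

mutual
  FreshT : ∀ {n} → ℕ → Term n → Set
  FreshT k (var i)   = ⊤
  FreshT k (par k')  = k ≢ k'
  FreshT k (fn f ts) = FreshTs k ts

  FreshTs : ∀ {n} → ℕ → List (Term n) → Set
  FreshTs k []       = ⊤
  FreshTs k (t ∷ ts) = FreshT k t × FreshTs k ts

FreshF : ∀ {n} → ℕ → Formula n → Set
FreshF k (atom P ts) = FreshTs k ts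
FreshF k (A ∧ B)     = FreshF k A × FreshF k B
FreshF k (A ∨ B)     = FreshF k A × FreshF k B
FreshF k (A ⇒ B)     = FreshF k A × FreshF k B
FreshF k (∀' A)      = FreshF k A
FreshF k (∃' A)      = FreshF k A

FreshCtx : ℕ → Ctx → Set
FreshCtx k Γ = All (FreshF k) Γ

-- Proof terms (hypothesis variables are de Bruijn indices into the
-- context; individual variables bound by λx.p and dest are parameters)

data Pf : Set where
  hyp  : ℕ → Pf
  pair : Pf → Pf → Pf
  π₁   : Pf → Pf
  π₂   : Pf → Pf
  ι₁   : Pf → Pf
  ι₂   : Pf → Pf
  case : Pf → Pf → Pf → Pf           -- case p of (a₁.q₁ ∥ a₂.q₂)  (a_i = hyp 0 in q_i)
  lam  : Pf → Pf                     -- λa.p  (a = hyp 0 in p)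
  app  : Pf → Pf → Pf
  tlam : ℕ → Pf → Pf                 -- λx.p  (x a parameter)
  tapp : Pf → CTerm → Pf
  wit  : CTerm → Pf → Pf
  dest : Pf → ℕ → Pf → Pf            -- dest p as (x , a) in q  (x parameter, a = hyp 0 in q)

data _∋_∶_ : Ctx → ℕ → CFormula → Set where
  here  : ∀ {Γ A} → (A ∷ Γ) ∋ 0 ∶ A
  there : ∀ {Γ A B i} → Γ ∋ i ∶ A → (B ∷ Γ) ∋ suc i ∶ A

infix 3 _⊢_∶_

data _⊢_∶_ : Ctx → Pf → CFormula → Set where
  ax    : ∀ {Γ i A} → Γ ∋ i ∶ A → Γ ⊢ hyp i ∶ A
  ∧I    : ∀ {Γ p q A B} → Γ ⊢ p ∶ A → Γ ⊢ q ∶ B → Γ ⊢ pair p q ∶ A ∧ B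
  ∧E₁   : ∀ {Γ p A B} → Γ ⊢ p ∶ A ∧ B → Γ ⊢ π₁ p ∶ A
  ∧E₂   : ∀ {Γ p A B} → Γ ⊢ p ∶ A ∧ B → Γ ⊢ π₂ p ∶ B
  ∨I₁   : ∀ {Γ p A B} → Γ ⊢ p ∶ A → Γ ⊢ ι₁ p ∶ A ∨ B
  ∨I₂   : ∀ {Γ p A B} → Γ ⊢ p ∶ B → Γ ⊢ ι₂ p ∶ A ∨ B
  ∨E    : ∀ {Γ p q₁ q₂ A₁ A₂ C} → Γ ⊢ p ∶ A₁ ∨ A₂ →
          (A₁ ∷ Γ) ⊢ q₁ ∶ C → (A₂ ∷ Γ) ⊢ q₂ ∶ C → Γ ⊢ case p q₁ q₂ ∶ C
  ⇒I    : ∀ {Γ p A B} → (A ∷ Γ) ⊢ p ∶ B → Γ ⊢ lam p ∶ A ⇒ B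
  ⇒E    : ∀ {Γ p q A B} → Γ ⊢ p ∶ A ⇒ B → Γ ⊢ q ∶ A → Γ ⊢ app p q ∶ B
  ∀I    : ∀ {Γ p x} {A : Formula 1} → FreshCtx x Γ → FreshF x (∀' A) →
          Γ ⊢ p ∶ A [ par x ] → Γ ⊢ tlam x p ∶ ∀' A
  ∀E    : ∀ {Γ p} {A : Formula 1} (t : CTerm) → Γ ⊢ p ∶ ∀' A → Γ ⊢ tapp p t ∶ A [ t ]
  ∃I    : ∀ {Γ p} {A : Formula 1} (t : CTerm) → Γ ⊢ p ∶ A [ t ] → Γ ⊢ wit t p ∶ ∃' A
  ∃E    : ∀ {Γ p q x C} {A : Formula 1} → FreshCtx x Γ → FreshF x (∃' A) → FreshF x C →
          Γ ⊢ p ∶ ∃' A → (A [ par x ] ∷ Γ) ⊢ q ∶ C → Γ ⊢ dest p x q ∶ C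

mutual
  data Normal : Pf → Set where
    ne   : ∀ {e} → Neutral e → Normal e
    lam  : ∀ {r} → Normal r → Normal (lam r)
    ι₁   : ∀ {r} → Normal r → Normal (ι₁ r)
    ι₂   : ∀ {r} → Normal r → Normal (ι₂ r)
    pair : ∀ {r₁ r₂} → Normal r₁ → Normal r₂ → Normal (pair r₁ r₂)
    tlam : ∀ {x r} → Normal r → Normal (tlam x r)
    wit  : ∀ {t r} → Normal r → Normal (wit t r)

  data Neutral : Pf → Set where
    hyp  : ∀ {a} → Neutral (hyp a)
    app  : ∀ {e r} → Neutral e → Normal r → Neutral (app e r)
    case : ∀ {e r₁ r₂} → Neutral e → Normal r₁ → Normal r₂ → Neutral (case e r₁ r₂)
    π₁   : ∀ {e} → Neutral e → Neutral (π₁ e)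
    π₂   : ∀ {e} → Neutral e → Neutral (π₂ e)
    tapp : ∀ {e t} → Neutral e → Neutral (tapp e t)
    dest : ∀ {e x r} → Neutral e → Normal r → Neutral (dest e x r)

NormalDerivable : Ctx → CFormula → Set
NormalDerivable Γ A = Σ Pf λ p → Normal p × (Γ ⊢ p ∶ A)

record IKCPS : Set₁ where
  field
    K      : Set
    _≤_    : K → K → Set
    ≤-refl  : ∀ {w} → w ≤ w
    ≤-trans : ∀ {w w' w''} → w ≤ w' → w' ≤ w'' → w ≤ w''
    _⊩⊥_   : K → CFormula → Set
    ⊩ₛatom : K → ℕ → List CTerm → Set
    D      : K → CTerm → Set
  -- (monotonicity of atomic strong forcing and of D are properties of a
  -- model that the forcing clauses below do not use)

module Forcing (M : IKCPS) where
  open IKCPS M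

  -- Forcing and strong forcing of (substitution instances of) formulas:
  -- ⊩ᵉ w A ρ  means  w ⊩ A[ρ]  (A with its bound variables instantiated by ρ).
  mutual
    ⊩ᵉ : ∀ {n} → K → Formula n → (Fin n → CTerm) → Set
    ⊩ᵉ w A ρ = ∀ (C : CFormula) (w' : K) → w ≤ w' →
               (∀ (w'' : K) → w' ≤ w'' → ⊩ₛᵉ w'' A ρ → w'' ⊩⊥ C) → w' ⊩⊥ C

    ⊩ₛᵉ : ∀ {n} → K → Formula n → (Fin n → CTerm) → Set
    ⊩ₛᵉ w (atom P ts) ρ = ⊩ₛatom w P (substTs ρ ts)
    ⊩ₛᵉ w (A ∧ B) ρ = ⊩ᵉ w A ρ × ⊩ᵉ w B ρ
    ⊩ₛᵉ w (A ∨ B) ρ = ⊩ᵉ w A ρ ⊎ ⊩ᵉ w B ρ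
    ⊩ₛᵉ w (A ⇒ B) ρ = ∀ (w' : K) → w ≤ w' → ⊩ᵉ w' A ρ → ⊩ᵉ w' B ρ
    ⊩ₛᵉ w (∀' A) ρ = ∀ (w' : K) → w ≤ w' → (t : CTerm) → D w' t → ⊩ᵉ w' A (ρ ▸ t)
    ⊩ₛᵉ w (∃' A) ρ = Σ CTerm λ t → D w t × ⊩ᵉ w A (ρ ▸ t)

  infix 2 _⊩_ _⊩ₛ_
  _⊩_ : K → CFormula → Set
  w ⊩ A = ⊩ᵉ w A emptyEnv

  _⊩ₛ_ : K → CFormula → Set
  w ⊩ₛ A = ⊩ₛᵉ w A emptyEnv

𝒰 : IKCPS
𝒰 = record
  { K       = Ctx
  ; _≤_     = _⊆_
  ; ≤-refl  = λ x → x
  ; ≤-trans = λ p q x → q (p x)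
  ; _⊩⊥_    = NormalDerivable
  ; ⊩ₛatom  = λ Γ P ts → NormalDerivable Γ (atom P ts)
  ; D       = λ _ _ → ⊤
  }

open Forcing 𝒰 public using () renaming (_⊩_ to _⊩𝒰_)

-- Reification and reflection are proved simultaneously by induction on the
-- formula, for substitution instances A[ρ] of open formulas so that the
-- quantifier cases can instantiate the bound variable.  Forcing in 𝒰 is a
-- continuation: reification runs it with the formula itself as answer type
-- and turns the strong forcing it receives into a normal proof by the
-- introduction rules.  Reflection of a neutral e feeds the continuation the
-- strong forcing obtained from the eliminations on e (projections,
-- application to a reified argument, instantiation), except for ∨ and ∃,
-- where it answers with case/dest on e and reflects the fresh hypotheses of
-- the branches.  Forcing quantifies over all larger contexts, so reflection
-- transports neutral derivations to them; as the new hypotheses may mention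
-- the eigenvariables of ∀I and ∃E, this weakening renames parameters.
module Submission where

open import Defs
open import Data.Product using (Σ; _×_; _,_)
open import Data.Nat using (ℕ; suc; _+_; _≤_)
open import Data.Nat.Properties using (m≤m+n; m≤n+m; m+n≤o⇒m≤o; m+n≤o⇒n≤o; <-irrefl; ≤-trans; _≟_)
open import Data.Fin using (Fin; zero; suc)
open import Data.List using (List; []; _∷_)
open import Data.List.Relation.Unary.All as All using ([]; _∷_)
open import Data.List.Relation.Unary.Any using (here; there)
open import Data.List.Membership.Propositional using (_∈_)
open import Data.List.Relation.Binary.Subset.Propositional using (_⊆_)
open import Data.Sum using (inj₁; inj₂)
open import Data.Unit using (tt)
open import Data.Empty using (⊥-elim)
open import Function using (id; _∘_)
open import Relation.Nullary using (yes; no)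
open import Relation.Binary.PropositionalEquality
  using (_≡_; _≗_; refl; sym; trans; cong; cong₂; subst)

open Forcing 𝒰

mutual
  substT-cong : ∀ {n m} {σ τ : Fin n → Term m} → σ ≗ τ → substT σ ≗ substT τ
  substT-cong σ≗τ (var i)   = σ≗τ i
  substT-cong σ≗τ (par k)   = refl
  substT-cong σ≗τ (fn f ts) = cong (fn f) (substTs-cong σ≗τ ts)

  substTs-cong : ∀ {n m} {σ τ : Fin n → Term m} → σ ≗ τ → substTs σ ≗ substTs τ
  substTs-cong σ≗τ []       = refl
  substTs-cong σ≗τ (t ∷ ts) = cong₂ _∷_ (substT-cong σ≗τ t) (substTs-cong σ≗τ ts)

exts-cong : ∀ {n m} {σ τ : Fin n → Term m} → σ ≗ τ → exts σ ≗ exts τ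
exts-cong σ≗τ zero    = refl
exts-cong σ≗τ (suc i) = cong (renT suc) (σ≗τ i)

substF-cong : ∀ {n m} {σ τ : Fin n → Term m} → σ ≗ τ → substF σ ≗ substF τ
substF-cong σ≗τ (atom P ts) = cong (atom P) (substTs-cong σ≗τ ts)
substF-cong σ≗τ (A ∧ B)     = cong₂ _∧_ (substF-cong σ≗τ A) (substF-cong σ≗τ B)
substF-cong σ≗τ (A ∨ B)     = cong₂ _∨_ (substF-cong σ≗τ A) (substF-cong σ≗τ B)
substF-cong σ≗τ (A ⇒ B)     = cong₂ _⇒_ (substF-cong σ≗τ A) (substF-cong σ≗τ B)
substF-cong σ≗τ (∀' A)      = cong ∀' (substF-cong (exts-cong σ≗τ) A)
substF-cong σ≗τ (∃' A)      = cong ∃' (substF-cong (exts-cong σ≗τ) A)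

mutual
  substT-renT : ∀ {n m k} (σ : Fin m → Term k) (r : Fin n → Fin m) (t : Term n) →
                substT σ (renT r t) ≡ substT (σ ∘ r) t
  substT-renT σ r (var i)   = refl
  substT-renT σ r (par k)   = refl
  substT-renT σ r (fn f ts) = cong (fn f) (substTs-renTs σ r ts)

  substTs-renTs : ∀ {n m k} (σ : Fin m → Term k) (r : Fin n → Fin m) (ts : List (Term n)) →
                  substTs σ (renTs r ts) ≡ substTs (σ ∘ r) ts
  substTs-renTs σ r []       = refl
  substTs-renTs σ r (t ∷ ts) = cong₂ _∷_ (substT-renT σ r t) (substTs-renTs σ r ts)

mutual
  renT-substT : ∀ {n m k} (r : Fin m → Fin k) (σ : Fin n → Term m) (t : Term n) →
                renT r (substT σ t) ≡ substT (renT r ∘ σ) t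
  renT-substT r σ (var i)   = refl
  renT-substT r σ (par k)   = refl
  renT-substT r σ (fn f ts) = cong (fn f) (renTs-substTs r σ ts)

  renTs-substTs : ∀ {n m k} (r : Fin m → Fin k) (σ : Fin n → Term m) (ts : List (Term n)) →
                  renTs r (substTs σ ts) ≡ substTs (renT r ∘ σ) ts
  renTs-substTs r σ []       = refl
  renTs-substTs r σ (t ∷ ts) = cong₂ _∷_ (renT-substT r σ t) (renTs-substTs r σ ts)

mutual
  substT-substT : ∀ {n m k} (σ : Fin m → Term k) (τ : Fin n → Term m) (t : Term n) →
                  substT σ (substT τ t) ≡ substT (substT σ ∘ τ) t
  substT-substT σ τ (var i)   = refl
  substT-substT σ τ (par k)   = refl
  substT-substT σ τ (fn f ts) = cong (fn f) (substTs-substTs σ τ ts)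

  substTs-substTs : ∀ {n m k} (σ : Fin m → Term k) (τ : Fin n → Term m) (ts : List (Term n)) →
                    substTs σ (substTs τ ts) ≡ substTs (substT σ ∘ τ) ts
  substTs-substTs σ τ []       = refl
  substTs-substTs σ τ (t ∷ ts) = cong₂ _∷_ (substT-substT σ τ t) (substTs-substTs σ τ ts)

exts-substT : ∀ {n m k} (σ : Fin m → Term k) (τ : Fin n → Term m) →
              substT (exts σ) ∘ exts τ ≗ exts (substT σ ∘ τ)
exts-substT σ τ zero    = refl
exts-substT σ τ (suc i) = trans (substT-renT (exts σ) suc (τ i)) (sym (renT-substT suc σ (τ i)))

substF-substF : ∀ {n m k} (σ : Fin m → Term k) (τ : Fin n → Term m) (A : Formula n) →
                substF σ (substF τ A) ≡ substF (substT σ ∘ τ) A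
substF-substF σ τ (atom P ts) = cong (atom P) (substTs-substTs σ τ ts)
substF-substF σ τ (A ∧ B)     = cong₂ _∧_ (substF-substF σ τ A) (substF-substF σ τ B)
substF-substF σ τ (A ∨ B)     = cong₂ _∨_ (substF-substF σ τ A) (substF-substF σ τ B)
substF-substF σ τ (A ⇒ B)     = cong₂ _⇒_ (substF-substF σ τ A) (substF-substF σ τ B)
substF-substF σ τ (∀' A)      =
  cong ∀' (trans (substF-substF (exts σ) (exts τ) A) (substF-cong (exts-substT σ τ) A))
substF-substF σ τ (∃' A)      =
  cong ∃' (trans (substF-substF (exts σ) (exts τ) A) (substF-cong (exts-substT σ τ) A))

mutual
  substT-id : ∀ {n} {σ : Fin n → Term n} → σ ≗ var → (t : Term n) → substT σ t ≡ t
  substT-id σ≗var (var i)   = σ≗var i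
  substT-id σ≗var (par k)   = refl
  substT-id σ≗var (fn f ts) = cong (fn f) (substTs-id σ≗var ts)

  substTs-id : ∀ {n} {σ : Fin n → Term n} → σ ≗ var → (ts : List (Term n)) → substTs σ ts ≡ ts
  substTs-id σ≗var []       = refl
  substTs-id σ≗var (t ∷ ts) = cong₂ _∷_ (substT-id σ≗var t) (substTs-id σ≗var ts)

exts-id : ∀ {n} {σ : Fin n → Term n} → σ ≗ var → exts σ ≗ var
exts-id σ≗var zero    = refl
exts-id σ≗var (suc i) = cong (renT suc) (σ≗var i)

substF-id : ∀ {n} {σ : Fin n → Term n} → σ ≗ var → (A : Formula n) → substF σ A ≡ A
substF-id σ≗var (atom P ts) = cong (atom P) (substTs-id σ≗var ts)
substF-id σ≗var (A ∧ B)     = cong₂ _∧_ (substF-id σ≗var A) (substF-id σ≗var B)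
substF-id σ≗var (A ∨ B)     = cong₂ _∨_ (substF-id σ≗var A) (substF-id σ≗var B)
substF-id σ≗var (A ⇒ B)     = cong₂ _⇒_ (substF-id σ≗var A) (substF-id σ≗var B)
substF-id σ≗var (∀' A)      = cong ∀' (substF-id (exts-id σ≗var) A)
substF-id σ≗var (∃' A)      = cong ∃' (substF-id (exts-id σ≗var) A)

substF-closed : (A : CFormula) → substF emptyEnv A ≡ A
substF-closed = substF-id (λ ())

substF-exts-[] : ∀ {n} (ρ : Fin n → CTerm) (A : Formula (suc n)) (t : CTerm) →
                 substF (exts ρ) A [ t ] ≡ substF (ρ ▸ t) A
substF-exts-[] ρ A t = trans (substF-substF (emptyEnv ▸ t) (exts ρ) A) (substF-cong pointwise A)
  where
  pointwise : substT (emptyEnv ▸ t) ∘ exts ρ ≗ ρ ▸ t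
  pointwise zero    = refl
  pointwise (suc i) = trans (substT-renT (emptyEnv ▸ t) suc (ρ i)) (substT-id (λ ()) (ρ i))

mutual
  mapParT : ∀ {n} → (ℕ → ℕ) → Term n → Term n
  mapParT π (var i)   = var i
  mapParT π (par k)   = par (π k)
  mapParT π (fn f ts) = fn f (mapParTs π ts)

  mapParTs : ∀ {n} → (ℕ → ℕ) → List (Term n) → List (Term n)
  mapParTs π []       = []
  mapParTs π (t ∷ ts) = mapParT π t ∷ mapParTs π ts

mapParF : ∀ {n} → (ℕ → ℕ) → Formula n → Formula n
mapParF π (atom P ts) = atom P (mapParTs π ts)
mapParF π (A ∧ B)     = mapParF π A ∧ mapParF π B
mapParF π (A ∨ B)     = mapParF π A ∨ mapParF π B
mapParF π (A ⇒ B)     = mapParF π A ⇒ mapParF π B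
mapParF π (∀' A)      = ∀' (mapParF π A)
mapParF π (∃' A)      = ∃' (mapParF π A)

mutual
  mapParT-renT : ∀ {n m} (π : ℕ → ℕ) (r : Fin n → Fin m) (t : Term n) →
                 mapParT π (renT r t) ≡ renT r (mapParT π t)
  mapParT-renT π r (var i)   = refl
  mapParT-renT π r (par k)   = refl
  mapParT-renT π r (fn f ts) = cong (fn f) (mapParTs-renTs π r ts)

  mapParTs-renTs : ∀ {n m} (π : ℕ → ℕ) (r : Fin n → Fin m) (ts : List (Term n)) →
                   mapParTs π (renTs r ts) ≡ renTs r (mapParTs π ts)
  mapParTs-renTs π r []       = refl
  mapParTs-renTs π r (t ∷ ts) = cong₂ _∷_ (mapParT-renT π r t) (mapParTs-renTs π r ts)

mutual
  mapParT-substT : ∀ {n m} (π : ℕ → ℕ) (σ : Fin n → Term m) (t : Term n) →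
                   mapParT π (substT σ t) ≡ substT (mapParT π ∘ σ) (mapParT π t)
  mapParT-substT π σ (var i)   = refl
  mapParT-substT π σ (par k)   = refl
  mapParT-substT π σ (fn f ts) = cong (fn f) (mapParTs-substTs π σ ts)

  mapParTs-substTs : ∀ {n m} (π : ℕ → ℕ) (σ : Fin n → Term m) (ts : List (Term n)) →
                     mapParTs π (substTs σ ts) ≡ substTs (mapParT π ∘ σ) (mapParTs π ts)
  mapParTs-substTs π σ []       = refl
  mapParTs-substTs π σ (t ∷ ts) = cong₂ _∷_ (mapParT-substT π σ t) (mapParTs-substTs π σ ts)

mapParT-exts : ∀ {n m} (π : ℕ → ℕ) (σ : Fin n → Term m) →
               mapParT π ∘ exts σ ≗ exts (mapParT π ∘ σ)
mapParT-exts π σ zero    = refl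
mapParT-exts π σ (suc i) = mapParT-renT π suc (σ i)

mapParF-substF : ∀ {n m} (π : ℕ → ℕ) (σ : Fin n → Term m) (A : Formula n) →
                 mapParF π (substF σ A) ≡ substF (mapParT π ∘ σ) (mapParF π A)
mapParF-substF π σ (atom P ts) = cong (atom P) (mapParTs-substTs π σ ts)
mapParF-substF π σ (A ∧ B)     = cong₂ _∧_ (mapParF-substF π σ A) (mapParF-substF π σ B)
mapParF-substF π σ (A ∨ B)     = cong₂ _∨_ (mapParF-substF π σ A) (mapParF-substF π σ B)
mapParF-substF π σ (A ⇒ B)     = cong₂ _⇒_ (mapParF-substF π σ A) (mapParF-substF π σ B)
mapParF-substF π σ (∀' A)      =
  cong ∀' (trans (mapParF-substF π (exts σ) A) (substF-cong (mapParT-exts π σ) (mapParF π A)))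
mapParF-substF π σ (∃' A)      =
  cong ∃' (trans (mapParF-substF π (exts σ) A) (substF-cong (mapParT-exts π σ) (mapParF π A)))

mapParF-[] : (π : ℕ → ℕ) (A : Formula 1) (t : CTerm) →
             mapParF π (A [ t ]) ≡ mapParF π A [ mapParT π t ]
mapParF-[] π A t = trans (mapParF-substF π (emptyEnv ▸ t) A) (substF-cong pointwise (mapParF π A))
  where
  pointwise : mapParT π ∘ (emptyEnv ▸ t) ≗ emptyEnv ▸ mapParT π t
  pointwise zero = refl

mutual
  mapParT-id : ∀ {n} (t : Term n) → mapParT id t ≡ t
  mapParT-id (var i)   = refl
  mapParT-id (par k)   = refl
  mapParT-id (fn f ts) = cong (fn f) (mapParTs-id ts)

  mapParTs-id : ∀ {n} (ts : List (Term n)) → mapParTs id ts ≡ ts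
  mapParTs-id []       = refl
  mapParTs-id (t ∷ ts) = cong₂ _∷_ (mapParT-id t) (mapParTs-id ts)

mapParF-id : ∀ {n} (A : Formula n) → mapParF id A ≡ A
mapParF-id (atom P ts) = cong (atom P) (mapParTs-id ts)
mapParF-id (A ∧ B)     = cong₂ _∧_ (mapParF-id A) (mapParF-id B)
mapParF-id (A ∨ B)     = cong₂ _∨_ (mapParF-id A) (mapParF-id B)
mapParF-id (A ⇒ B)     = cong₂ _⇒_ (mapParF-id A) (mapParF-id B)
mapParF-id (∀' A)      = cong ∀' (mapParF-id A)
mapParF-id (∃' A)      = cong ∃' (mapParF-id A)

update : (ℕ → ℕ) → ℕ → ℕ → ℕ → ℕ
update π x y k with x ≟ k
... | yes _ = y
... | no _  = π k

update-≡ : ∀ π x y → update π x y x ≡ y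
update-≡ π x y with x ≟ x
... | yes _ = refl
... | no x≢x = ⊥-elim (x≢x refl)

mutual
  mapParT-update-fresh : ∀ {n π x y} (t : Term n) → FreshT x t →
                         mapParT (update π x y) t ≡ mapParT π t
  mapParT-update-fresh (var i)   _     = refl
  mapParT-update-fresh {x = x} (par k) x≢k with x ≟ k
  ... | yes x≡k = ⊥-elim (x≢k x≡k)
  ... | no _    = refl
  mapParT-update-fresh (fn f ts) fresh = cong (fn f) (mapParTs-update-fresh ts fresh)

  mapParTs-update-fresh : ∀ {n π x y} (ts : List (Term n)) → FreshTs x ts →
                          mapParTs (update π x y) ts ≡ mapParTs π ts
  mapParTs-update-fresh []       _                = refl
  mapParTs-update-fresh (t ∷ ts) (fresh , freshs) =
    cong₂ _∷_ (mapParT-update-fresh t fresh) (mapParTs-update-fresh ts freshs)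

mapParF-update-fresh : ∀ {n π x y} (A : Formula n) → FreshF x A →
                       mapParF (update π x y) A ≡ mapParF π A
mapParF-update-fresh (atom P ts) fresh     = cong (atom P) (mapParTs-update-fresh ts fresh)
mapParF-update-fresh (A ∧ B)     (fA , fB) =
  cong₂ _∧_ (mapParF-update-fresh A fA) (mapParF-update-fresh B fB)
mapParF-update-fresh (A ∨ B)     (fA , fB) =
  cong₂ _∨_ (mapParF-update-fresh A fA) (mapParF-update-fresh B fB)
mapParF-update-fresh (A ⇒ B)     (fA , fB) =
  cong₂ _⇒_ (mapParF-update-fresh A fA) (mapParF-update-fresh B fB)
mapParF-update-fresh (∀' A)      fresh     = cong ∀' (mapParF-update-fresh A fresh)
mapParF-update-fresh (∃' A)      fresh     = cong ∃' (mapParF-update-fresh A fresh)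

mapParF-update-[par] : ∀ π x y (A : Formula 1) → FreshF x A →
                       mapParF (update π x y) (A [ par x ]) ≡ mapParF π A [ par y ]
mapParF-update-[par] π x y A fresh =
  trans (mapParF-[] (update π x y) A (par x))
        (cong₂ _[_] (mapParF-update-fresh A fresh) (cong par (update-≡ π x y)))

mutual
  parBoundT : ∀ {n} → Term n → ℕ
  parBoundT (var i)   = 0
  parBoundT (par k)   = suc k
  parBoundT (fn f ts) = parBoundTs ts

  parBoundTs : ∀ {n} → List (Term n) → ℕ
  parBoundTs []       = 0
  parBoundTs (t ∷ ts) = parBoundT t + parBoundTs ts

parBoundF : ∀ {n} → Formula n → ℕ
parBoundF (atom P ts) = parBoundTs ts
parBoundF (A ∧ B)     = parBoundF A + parBoundF B
parBoundF (A ∨ B)     = parBoundF A + parBoundF B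
parBoundF (A ⇒ B)     = parBoundF A + parBoundF B
parBoundF (∀' A)      = parBoundF A
parBoundF (∃' A)      = parBoundF A

parBoundCtx : Ctx → ℕ
parBoundCtx []      = 0
parBoundCtx (A ∷ Γ) = parBoundF A + parBoundCtx Γ

mutual
  parBoundT≤⇒FreshT : ∀ {n k} (t : Term n) → parBoundT t ≤ k → FreshT k t
  parBoundT≤⇒FreshT (var i)   _  = tt
  parBoundT≤⇒FreshT (par k)   le = λ eq → <-irrefl (sym eq) le
  parBoundT≤⇒FreshT (fn f ts) le = parBoundTs≤⇒FreshTs ts le

  parBoundTs≤⇒FreshTs : ∀ {n k} (ts : List (Term n)) → parBoundTs ts ≤ k → FreshTs k ts
  parBoundTs≤⇒FreshTs []       _  = tt
  parBoundTs≤⇒FreshTs (t ∷ ts) le =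
      parBoundT≤⇒FreshT t (m+n≤o⇒m≤o (parBoundT t) le)
    , parBoundTs≤⇒FreshTs ts (m+n≤o⇒n≤o (parBoundT t) le)

parBoundF≤⇒FreshF : ∀ {n k} (A : Formula n) → parBoundF A ≤ k → FreshF k A
parBoundF≤⇒FreshF (atom P ts) le = parBoundTs≤⇒FreshTs ts le
parBoundF≤⇒FreshF (A ∧ B) le = parBoundF≤⇒FreshF A (m+n≤o⇒m≤o (parBoundF A) le)
                              , parBoundF≤⇒FreshF B (m+n≤o⇒n≤o (parBoundF A) le)
parBoundF≤⇒FreshF (A ∨ B) le = parBoundF≤⇒FreshF A (m+n≤o⇒m≤o (parBoundF A) le)
                              , parBoundF≤⇒FreshF B (m+n≤o⇒n≤o (parBoundF A) le)
parBoundF≤⇒FreshF (A ⇒ B) le = parBoundF≤⇒FreshF A (m+n≤o⇒m≤o (parBoundF A) le)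
                              , parBoundF≤⇒FreshF B (m+n≤o⇒n≤o (parBoundF A) le)
parBoundF≤⇒FreshF (∀' A)  le = parBoundF≤⇒FreshF A le
parBoundF≤⇒FreshF (∃' A)  le = parBoundF≤⇒FreshF A le

parBoundCtx≤⇒FreshCtx : ∀ {k} (Γ : Ctx) → parBoundCtx Γ ≤ k → FreshCtx k Γ
parBoundCtx≤⇒FreshCtx []      _  = []
parBoundCtx≤⇒FreshCtx (A ∷ Γ) le =
    parBoundF≤⇒FreshF A (m+n≤o⇒m≤o (parBoundF A) le)
  ∷ parBoundCtx≤⇒FreshCtx Γ (m+n≤o⇒n≤o (parBoundF A) le)

module _ {n m} (Γ : Ctx) (A : Formula n) (C : Formula m) where

  freshPar : ℕ
  freshPar = parBoundCtx Γ + (parBoundF A + parBoundF C)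

  freshPar-Ctx : FreshCtx freshPar Γ
  freshPar-Ctx = parBoundCtx≤⇒FreshCtx Γ (m≤m+n (parBoundCtx Γ) _)

  freshPar-F₁ : FreshF freshPar A
  freshPar-F₁ =
    parBoundF≤⇒FreshF A (≤-trans (m≤m+n (parBoundF A) (parBoundF C)) (m≤n+m _ (parBoundCtx Γ)))

  freshPar-F₂ : FreshF freshPar C
  freshPar-F₂ =
    parBoundF≤⇒FreshF C (≤-trans (m≤n+m (parBoundF C) (parBoundF A)) (m≤n+m _ (parBoundCtx Γ)))

NeutralDerivable : Ctx → CFormula → Set
NeutralDerivable Γ A = Σ Pf λ e → Neutral e × (Γ ⊢ e ∶ A)

∈⇒∋ : ∀ {Γ B} → B ∈ Γ → Σ ℕ λ i → Γ ∋ i ∶ B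
∈⇒∋ (here refl) = 0 , here
∈⇒∋ (there B∈Γ) with ∈⇒∋ B∈Γ
... | i , Γ∋i = suc i , there Γ∋i

∋⇒∈ : ∀ {Γ i B} → Γ ∋ i ∶ B → B ∈ Γ
∋⇒∈ here      = here refl
∋⇒∈ (there h) = there (∋⇒∈ h)

axⁿᵉ : ∀ {Γ B} → B ∈ Γ → NeutralDerivable Γ B
axⁿᵉ B∈Γ with ∈⇒∋ B∈Γ
... | i , Γ∋i = hyp i , hyp , ax Γ∋i

∧E₁ⁿᵉ : ∀ {Γ A B} → NeutralDerivable Γ (A ∧ B) → NeutralDerivable Γ A
∧E₁ⁿᵉ (e , neu , d) = π₁ e , π₁ neu , ∧E₁ d

∧E₂ⁿᵉ : ∀ {Γ A B} → NeutralDerivable Γ (A ∧ B) → NeutralDerivable Γ B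
∧E₂ⁿᵉ (e , neu , d) = π₂ e , π₂ neu , ∧E₂ d

⇒Eⁿᵉ : ∀ {Γ A B} → NeutralDerivable Γ (A ⇒ B) → NormalDerivable Γ A → NeutralDerivable Γ B
⇒Eⁿᵉ (e , neu , d) (r , nr , dr) = app e r , app neu nr , ⇒E d dr

∀Eⁿᵉ : ∀ {Γ} {A : Formula 1} (t : CTerm) → NeutralDerivable Γ (∀' A) → NeutralDerivable Γ (A [ t ])
∀Eⁿᵉ t (e , neu , d) = tapp e t , tapp neu , ∀E t d

∨Eⁿᵉ : ∀ {Γ A₁ A₂ C} → NeutralDerivable Γ (A₁ ∨ A₂) →
       NormalDerivable (A₁ ∷ Γ) C → NormalDerivable (A₂ ∷ Γ) C → NeutralDerivable Γ C
∨Eⁿᵉ (e , neu , d) (r₁ , nr₁ , d₁) (r₂ , nr₂ , d₂) =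
  case e r₁ r₂ , case neu nr₁ nr₂ , ∨E d d₁ d₂

∃Eⁿᵉ : ∀ {Γ x C} {A : Formula 1} → FreshCtx x Γ → FreshF x (∃' A) → FreshF x C →
       NeutralDerivable Γ (∃' A) → NormalDerivable (A [ par x ] ∷ Γ) C → NeutralDerivable Γ C
∃Eⁿᵉ {x = x} fΓ fA fC (e , neu , d) (r , nr , dr) = dest e x r , dest neu nr , ∃E fΓ fA fC d dr

neⁿᶠ : ∀ {Γ A} → NeutralDerivable Γ A → NormalDerivable Γ A
neⁿᶠ (e , neu , d) = e , ne neu , d

∧Iⁿᶠ : ∀ {Γ A B} → NormalDerivable Γ A → NormalDerivable Γ B → NormalDerivable Γ (A ∧ B)
∧Iⁿᶠ (r₁ , nr₁ , d₁) (r₂ , nr₂ , d₂) = pair r₁ r₂ , pair nr₁ nr₂ , ∧I d₁ d₂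

∨I₁ⁿᶠ : ∀ {Γ A B} → NormalDerivable Γ A → NormalDerivable Γ (A ∨ B)
∨I₁ⁿᶠ (r , nr , d) = ι₁ r , ι₁ nr , ∨I₁ d

∨I₂ⁿᶠ : ∀ {Γ A B} → NormalDerivable Γ B → NormalDerivable Γ (A ∨ B)
∨I₂ⁿᶠ (r , nr , d) = ι₂ r , ι₂ nr , ∨I₂ d

⇒Iⁿᶠ : ∀ {Γ A B} → NormalDerivable (A ∷ Γ) B → NormalDerivable Γ (A ⇒ B)
⇒Iⁿᶠ (r , nr , d) = lam r , lam nr , ⇒I d

∀Iⁿᶠ : ∀ {Γ x} {A : Formula 1} → FreshCtx x Γ → FreshF x (∀' A) →
       NormalDerivable Γ (A [ par x ]) → NormalDerivable Γ (∀' A)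
∀Iⁿᶠ {x = x} fΓ fA (r , nr , d) = tlam x r , tlam nr , ∀I fΓ fA d

∃Iⁿᶠ : ∀ {Γ} {A : Formula 1} (t : CTerm) → NormalDerivable Γ (A [ t ]) → NormalDerivable Γ (∃' A)
∃Iⁿᶠ t (r , nr , d) = wit t r , wit nr , ∃I t d

ParRen : (ℕ → ℕ) → Ctx → Ctx → Set
ParRen π Γ Δ = ∀ {B} → B ∈ Γ → mapParF π B ∈ Δ

ParRen-∷ : ∀ {π Γ Δ B B'} → ParRen π Γ Δ → mapParF π B ≡ B' → ParRen π (B ∷ Γ) (B' ∷ Δ)
ParRen-∷ ren eq (here refl) = here eq
ParRen-∷ ren eq (there B∈Γ) = there (ren B∈Γ)

ParRen-update : ∀ {π x y Γ Δ} → FreshCtx x Γ → ParRen π Γ Δ → ParRen (update π x y) Γ Δ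
ParRen-update {Δ = Δ} fΓ ren {B} B∈Γ =
  subst (_∈ Δ) (sym (mapParF-update-fresh B (All.lookup fΓ B∈Γ))) (ren B∈Γ)

-- The eigenvariable x of ∀I/∃E is replaced by a parameter y fresh for Δ: update π x y sends x
-- to y and, since x is fresh for Γ, still maps the hypotheses of Γ into Δ.
mutual
  renameNe : ∀ {π Γ Δ e A} → ParRen π Γ Δ → Neutral e → Γ ⊢ e ∶ A →
             NeutralDerivable Δ (mapParF π A)
  renameNe ren hyp              (ax h)       = axⁿᵉ (ren (∋⇒∈ h))
  renameNe ren (app neu nr)     (⇒E d dr)    = ⇒Eⁿᵉ (renameNe ren neu d) (renameNf ren nr dr)
  renameNe ren (π₁ neu)         (∧E₁ d)      = ∧E₁ⁿᵉ (renameNe ren neu d)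
  renameNe ren (π₂ neu)         (∧E₂ d)      = ∧E₂ⁿᵉ (renameNe ren neu d)
  renameNe ren (case neu n₁ n₂) (∨E d d₁ d₂) =
    ∨Eⁿᵉ (renameNe ren neu d)
         (renameNf (ParRen-∷ ren refl) n₁ d₁)
         (renameNf (ParRen-∷ ren refl) n₂ d₂)
  renameNe {π} {Δ = Δ} ren (tapp neu) (∀E {A = A} t d) =
    subst (NeutralDerivable Δ) (sym (mapParF-[] π A t)) (∀Eⁿᵉ (mapParT π t) (renameNe ren neu d))
  renameNe {π} {Δ = Δ} ren (dest neu nr) (∃E {x = x} {C = C} {A = A} fΓ fA fC d dr) =
    ∃Eⁿᵉ (freshPar-Ctx Δ A' C') (freshPar-F₁ Δ A' C') (freshPar-F₂ Δ A' C')
         (renameNe ren neu d)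
         (subst (NormalDerivable (A' [ par y ] ∷ Δ)) (mapParF-update-fresh C fC)
                (renameNf (ParRen-∷ (ParRen-update fΓ ren) (mapParF-update-[par] π x y A fA)) nr dr))
    where
    A' = mapParF π A
    C' = mapParF π C
    y  = freshPar Δ A' C'

  renameNf : ∀ {π Γ Δ r A} → ParRen π Γ Δ → Normal r → Γ ⊢ r ∶ A →
             NormalDerivable Δ (mapParF π A)
  renameNf ren (ne neu)       d          = neⁿᶠ (renameNe ren neu d)
  renameNf ren (lam nr)       (⇒I d)     = ⇒Iⁿᶠ (renameNf (ParRen-∷ ren refl) nr d)
  renameNf ren (ι₁ nr)        (∨I₁ d)    = ∨I₁ⁿᶠ (renameNf ren nr d)
  renameNf ren (ι₂ nr)        (∨I₂ d)    = ∨I₂ⁿᶠ (renameNf ren nr d)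
  renameNf ren (pair nr₁ nr₂) (∧I d₁ d₂) = ∧Iⁿᶠ (renameNf ren nr₁ d₁) (renameNf ren nr₂ d₂)
  renameNf {π} {Δ = Δ} ren (tlam nr) (∀I {x = x} {A = A} fΓ fA d) =
    ∀Iⁿᶠ (freshPar-Ctx Δ A' A') (freshPar-F₁ Δ A' A')
         (subst (NormalDerivable Δ) (mapParF-update-[par] π x y A fA)
                (renameNf (ParRen-update fΓ ren) nr d))
    where
    A' = mapParF π A
    y  = freshPar Δ A' A'
  renameNf {π} {Δ = Δ} ren (wit nr) (∃I {A = A} t d) =
    ∃Iⁿᶠ (mapParT π t) (subst (NormalDerivable Δ) (mapParF-[] π A t) (renameNf ren nr d))

weakenNe : ∀ {Γ Δ A} → Γ ⊆ Δ → NeutralDerivable Γ A → NeutralDerivable Δ A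
weakenNe {Δ = Δ} {A} Γ⊆Δ (e , neu , d) =
  subst (NeutralDerivable Δ) (mapParF-id A) (renameNe ren neu d)
  where
  ren : ParRen id _ Δ
  ren {B} B∈Γ = subst (_∈ Δ) (sym (mapParF-id B)) (Γ⊆Δ B∈Γ)

mutual
  reify : ∀ {n} (A : Formula n) ρ Γ → ⊩ᵉ Γ A ρ → NormalDerivable Γ (substF ρ A)
  reify A ρ Γ ⊩A = ⊩A (substF ρ A) Γ id (λ Δ _ → reifyₛ A ρ Δ)

  reifyₛ : ∀ {n} (A : Formula n) ρ Γ → ⊩ₛᵉ Γ A ρ → NormalDerivable Γ (substF ρ A)
  reifyₛ (atom P ts) ρ Γ ⊩ₛP       = ⊩ₛP
  reifyₛ (A ∧ B)     ρ Γ (⊩A , ⊩B) = ∧Iⁿᶠ (reify A ρ Γ ⊩A) (reify B ρ Γ ⊩B)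
  reifyₛ (A ∨ B)     ρ Γ (inj₁ ⊩A) = ∨I₁ⁿᶠ (reify A ρ Γ ⊩A)
  reifyₛ (A ∨ B)     ρ Γ (inj₂ ⊩B) = ∨I₂ⁿᶠ (reify B ρ Γ ⊩B)
  reifyₛ (A ⇒ B)     ρ Γ ⊩A⇒B      =
    ⇒Iⁿᶠ (reify B ρ (A' ∷ Γ) (⊩A⇒B (A' ∷ Γ) there (reflect A ρ (axⁿᵉ (here refl)))))
    where
    A' = substF ρ A
  reifyₛ (∀' A)      ρ Γ ⊩∀A       =
    ∀Iⁿᶠ (freshPar-Ctx Γ A' A') (freshPar-F₁ Γ A' A')
         (subst (NormalDerivable Γ) (sym (substF-exts-[] ρ A (par x)))
                (reify A (ρ ▸ par x) Γ (⊩∀A Γ id (par x) tt)))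
    where
    A' = substF (exts ρ) A
    x  = freshPar Γ A' A'
  reifyₛ (∃' A)      ρ Γ (t , _ , ⊩At) =
    ∃Iⁿᶠ t (subst (NormalDerivable Γ) (sym (substF-exts-[] ρ A t)) (reify A (ρ ▸ t) Γ ⊩At))

  reflect : ∀ {n} (A : Formula n) ρ {Γ} → NeutralDerivable Γ (substF ρ A) → ⊩ᵉ Γ A ρ
  reflect A ρ e C Δ Γ⊆Δ k = reflectInto A ρ (weakenNe Γ⊆Δ e) C k

  reflectInto : ∀ {n} (A : Formula n) ρ {Γ} → NeutralDerivable Γ (substF ρ A) → (C : CFormula) →
                (∀ Δ → Γ ⊆ Δ → ⊩ₛᵉ Δ A ρ → NormalDerivable Δ C) → NormalDerivable Γ C
  reflectInto (atom P ts) ρ e C k = k _ id (neⁿᶠ e)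
  reflectInto (A ∧ B)     ρ e C k = k _ id (reflect A ρ (∧E₁ⁿᵉ e) , reflect B ρ (∧E₂ⁿᵉ e))
  reflectInto (A ∨ B)     ρ e C k =
    neⁿᶠ (∨Eⁿᵉ e (k _ there (inj₁ (reflect A ρ (axⁿᵉ (here refl)))))
                 (k _ there (inj₂ (reflect B ρ (axⁿᵉ (here refl))))))
  reflectInto (A ⇒ B)     ρ e C k =
    k _ id (λ Δ Γ⊆Δ ⊩A → reflect B ρ (⇒Eⁿᵉ (weakenNe Γ⊆Δ e) (reify A ρ Δ ⊩A)))
  reflectInto (∀' A)      ρ e C k =
    k _ id (λ Δ Γ⊆Δ t _ →
      reflect A (ρ ▸ t) (subst (NeutralDerivable Δ) (substF-exts-[] ρ A t) (∀Eⁿᵉ t (weakenNe Γ⊆Δ e))))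
  reflectInto (∃' A)      ρ {Γ} e C k =
    neⁿᶠ (∃Eⁿᵉ (freshPar-Ctx Γ A' C) (freshPar-F₁ Γ A' C) (freshPar-F₂ Γ A' C) e
               (k _ there (par x , tt , reflect A (ρ ▸ par x) hypothesis)))
    where
    A' = substF (exts ρ) A
    x  = freshPar Γ A' C
    hypothesis : NeutralDerivable (A' [ par x ] ∷ Γ) (substF (ρ ▸ par x) A)
    hypothesis = subst (NeutralDerivable _) (substF-exts-[] ρ A (par x)) (axⁿᵉ (here refl))

theorem14 : ((Γ : Ctx) (A : CFormula) → Γ ⊩𝒰 A → Σ Pf λ p → Normal p × (Γ ⊢ p ∶ A))
            × ((Γ : Ctx) (A : CFormula) (e : Pf) → Neutral e → Γ ⊢ e ∶ A → Γ ⊩𝒰 A)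
theorem14 =
    (λ Γ A ⊩A → subst (NormalDerivable Γ) (substF-closed A) (reify A emptyEnv Γ ⊩A))
  , (λ Γ A e neu d → reflect A emptyEnv (e , neu , subst (Γ ⊢ e ∶_) (sym (substF-closed A)) d))
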